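{- Let $\mathcal{G}$ be a connected RCOP block graph. Let $c\leftrightarrow j$ and $c\leftrightarrow l$ be two shortest paths (with $j\neq c\neq l$) that intersect only in the vertex $c$. Let $a$ be the vertex following $c$ on $c\leftrightarrow j$ and let $b$ be the vertex following $c$ on $c\leftrightarrow l$, and suppose $\lambda(\{c,a\})\neq\lambda(\{c,b\})$. Then either the shortest path $a\leftrightarrow j$ contains no edge of color $\lambda(\{c,b\})$, or the shortest path $b\leftrightarrow l$ contains no edge of color $\lambda(\{c,a\})$.
   Context: A colored graph $\mathcal{G}$ is a finite simple undirected graph on vertex set $[n]$ with a coloring $\lambda$ of its vertices and edges; $\Gamma(\mathcal{G})$ is the group of graph automorphisms preserving all vertex and edge colors. $\mathcal{G}$ is RCOP if the vertex colors and edge colors form disjoint sets, any two same-colored vertices are mapped to one another by some element of $\Gamma(\mathcal{G})$, and any two same-colored edges are mapped to one another by some element of $\Gamma(\mathcal{G})$. A graph on $[n]$ is a block graph if there is a vertex $c$ and a partition of $[n]$ into disjoint sets $A,B,\{c\}$ such that every path from $A$ to $B$ contains $c$, and the induced subgraphs on $A\cup\{c\}$ and $B\cup\{c\}$ are each complete graphs or block graphs. In a connected block graph any two vertices $u,v$ are joined by a unique shortest path, denoted $u\leftrightarrow v$. -}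

module Defs where

open import Data.Nat using (ℕ; _≤_)
open import Data.Bool using (Bool; true; false; T)
open import Data.Fin using (Fin)
open import Data.Fin.Subset using (Subset; _∈_; _∉_; _∪_; ⁅_⁆; ⊤)
open import Data.Fin.Permutation using (Permutation′; _⟨$⟩ʳ_)
open import Data.List using (List; []; _∷_; length; zip; head; last)
import Data.List as L
open import Data.List.Relation.Unary.All using (All)
open import Data.List.Relation.Unary.Linked using (Linked)
open import Data.List.Relation.Unary.Unique.Propositional using (Unique)
import Data.List.Membership.Propositional as LM
open import Data.Maybe using (Maybe; just)
open import Data.Product using (Σ; ∃; _×_; _,_)
open import Data.Sum using (_⊎_)
open import Relation.Binary.PropositionalEquality using (_≡_; _≢_)
open import Relation.Nullary using (¬_)

-- Adjacency is a Bool-valued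
-- symmetric irreflexive relation (finite simple undirected graph).
-- λ is given by a vertex coloring and an edge coloring (the edge coloring is
-- a symmetric function on pairs; only its values on edges are ever used).
record ColoredGraph (n : ℕ) : Set₁ where
  field
    Color   : Set
    adj     : Fin n → Fin n → Bool
    adj-sym : ∀ u v → adj u v ≡ adj v u
    adj-irr : ∀ u → adj u u ≡ false
    vcol    : Fin n → Color
    ecol    : Fin n → Fin n → Color
    ecol-sym : ∀ u v → ecol u v ≡ ecol v u

  Adj : Fin n → Fin n → Set
  Adj u v = T (adj u v)

module _ {n : ℕ} (G : ColoredGraph n) where
  open ColoredGraph G

  IsAut : Permutation′ n → Set
  IsAut σ = (∀ u v → adj (σ ⟨$⟩ʳ u) (σ ⟨$⟩ʳ v) ≡ adj u v)
          × (∀ u → vcol (σ ⟨$⟩ʳ u) ≡ vcol u)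
          × (∀ u v → Adj u v → ecol (σ ⟨$⟩ʳ u) (σ ⟨$⟩ʳ v) ≡ ecol u v)

  IsRCOP : Set
  IsRCOP =
      (∀ w u v → Adj u v → vcol w ≢ ecol u v)
    × (∀ u v → vcol u ≡ vcol v → Σ (Permutation′ n) λ σ → IsAut σ × σ ⟨$⟩ʳ u ≡ v)
    × (∀ u v x y → Adj u v → Adj x y → ecol u v ≡ ecol x y →
         Σ (Permutation′ n) λ σ → IsAut σ ×
           ((σ ⟨$⟩ʳ u ≡ x × σ ⟨$⟩ʳ v ≡ y) ⊎ (σ ⟨$⟩ʳ u ≡ y × σ ⟨$⟩ʳ v ≡ x)))

  IsPath : Fin n → Fin n → List (Fin n) → Set
  IsPath u v p = head p ≡ just u × last p ≡ just v × Linked Adj p × Unique p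

  IsShortestPath : Fin n → Fin n → List (Fin n) → Set
  IsShortestPath u v p = IsPath u v p × (∀ q → IsPath u v q → length p ≤ length q)

  Connected : Set
  Connected = ∀ u v → ∃ λ p → IsPath u v p

  IsPathIn : Subset n → Fin n → Fin n → List (Fin n) → Set
  IsPathIn S u v p = IsPath u v p × All (_∈ S) p

  Complete : Subset n → Set
  Complete S = ∀ x y → x ∈ S → y ∈ S → x ≢ y → Adj x y

  data BlockOrComplete (S : Subset n) : Set where
    complete : Complete S → BlockOrComplete S
    split    : (c : Fin n) (A B : Subset n) →
               c ∈ S →
               (∀ x → x ∈ A → x ∈ S) → (∀ x → x ∈ B → x ∈ S) →
               c ∉ A → c ∉ B → (∀ x → x ∈ A → x ∉ B) →
               (∀ x → x ∈ S → x ≡ c ⊎ x ∈ A ⊎ x ∈ B) →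
               (∀ x y p → x ∈ A → y ∈ B → IsPathIn S x y p → c LM.∈ p) →
               BlockOrComplete (A ∪ ⁅ c ⁆) → BlockOrComplete (B ∪ ⁅ c ⁆) →
               BlockOrComplete S

  -- The whole graph (vertex set [n]) is a block graph.  Note: a complete
  -- graph is a block graph under the paper's definition too (take A = ∅).
  IsBlockGraph : Set
  IsBlockGraph = BlockOrComplete ⊤

  pathEdges : List (Fin n) → List (Fin n × Fin n)
  pathEdges p = zip p (L.drop 1 p)

  NoEdgeOfColor : Color → List (Fin n) → Set
  NoEdgeOfColor χ p = All (λ { (x , y) → ecol x y ≢ χ }) (pathEdges p)

-- The midpoint q of an induced path p – q – r in a block graph lies on every walk from p to r
-- (contract the far side of a cut vertex onto it and induct on the block decomposition). So the
-- distance to a fixed vertex never has a non-strict maximum at q: along a geodesic the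
-- eccentricity e increases strictly after any step on which it does not decrease, and no two
-- neighbours of c are both closer than c to a vertex farthest from c. Automorphisms preserve e,
-- so in an RCOP graph equally coloured edges have equal sums of end eccentricities. If
-- e(b) ≤ e(a), then e(c) ≤ e(a), every edge of a ↔ j has eccentricity sum above 2e(a), which is
-- at least e(c) + e(b), and therefore none of them has the colour of {c, b}.

module Submission where

open import Defs
open import Data.Bool using (T)
open import Data.Bool.Properties using (T?)
open import Data.Empty using (⊥; ⊥-elim)
open import Data.Fin using (Fin) renaming (_≟_ to _≟ᶠ_)
open import Data.Fin.Permutation using (_⟨$⟩ʳ_; _⟨$⟩ˡ_; inverseˡ; inverseʳ)
open import Data.Fin.Properties using (any?)
open import Data.Fin.Subset using (Subset; ⁅_⁆; _∪_; ⊤) renaming (_∈_ to _∈ₛ_; _∉_ to _∉ₛ_)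
open import Data.Fin.Subset.Properties using (_∈?_; ∈⊤; x∈⁅x⁆; x∈⁅y⁆⇒x≡y; x∈p∪q⁺; x∈p∪q⁻)
open import Data.List using (List; []; _∷_; length; _++_; map; last; allFin)
open import Data.List.Extrema.Nat using (argmax; f[xs]≤f[argmax])
open import Data.List.Membership.Propositional using (_∈_)
open import Data.List.Membership.Propositional.Properties using (∈-∃++; ∈-++⁺ʳ; ∈-map⁻; ∈-allFin)
import Data.List.Membership.DecPropositional as DecMembership
open import Data.List.Properties using (length-++-≤ʳ)
open import Data.List.Relation.Binary.Subset.Propositional using (_⊆_)
open import Data.List.Relation.Unary.All as All using (All; []; _∷_)
open import Data.List.Relation.Unary.All.Properties using (¬Any⇒All¬; anti-mono; map⁺)
open import Data.List.Relation.Unary.Any using (here; there)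
open import Data.List.Relation.Unary.AllPairs using ([]; _∷_)
open import Data.List.Relation.Unary.Linked as Linked using (Linked; []; [-]; _∷_)
open import Data.List.Relation.Unary.Unique.Propositional using (Unique)
open import Data.Maybe using (just)
open import Data.Maybe.Properties using (just-injective)
open import Data.Nat using (ℕ; zero; suc; _+_; _≤_; _<_; z≤n; s≤s)
open import Data.Nat.Properties
open import Data.Product using (Σ; ∃; _×_; _,_; proj₁; proj₂)
open import Data.Sum as Sum using (_⊎_; inj₁; inj₂)
open import Function using (_∘_)
open import Relation.Binary.Construct.Closure.Reflexive as ReflClosure using (ReflClosure; refl; [_])
import Relation.Binary.Construct.Closure.Reflexive.Properties as ReflClosureₚ
open import Relation.Binary.PropositionalEquality using (_≡_; _≢_; refl; sym; trans; cong; cong₂; subst; subst₂)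
open import Relation.Nullary using (¬_; Dec; yes; no)
open import Relation.Nullary.Decidable using (_×-dec_)
open import Relation.Unary using (Decidable)

module _ {A : Set} where

  last-++-∷ : (xs : List A) (u : A) (ys : List A) → last (xs ++ u ∷ ys) ≡ last (u ∷ ys)
  last-++-∷ []           _ _  = refl
  last-++-∷ (_ ∷ [])     _ _  = refl
  last-++-∷ (_ ∷ y ∷ xs) u ys = last-++-∷ (y ∷ xs) u ys

  linked-++⁻ʳ : ∀ {R : A → A → Set} xs {ys} → Linked R (xs ++ ys) → Linked R ys
  linked-++⁻ʳ []       l = l
  linked-++⁻ʳ (_ ∷ xs) l = linked-++⁻ʳ xs (Linked.tail l)

  unique-++⁻ʳ : ∀ xs {ys : List A} → Unique (xs ++ ys) → Unique ys
  unique-++⁻ʳ []       u       = u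
  unique-++⁻ʳ (_ ∷ xs) (_ ∷ u) = unique-++⁻ʳ xs u

least : {P : ℕ → Set} → Decidable P → ∀ {B} → P B → ∃ λ k → P k × (∀ {m} → P m → k ≤ m)
least P? {zero} p0 = zero , p0 , λ _ → z≤n
least {P} P? {suc B} pB with P? zero
... | yes p0 = zero , p0 , λ _ → z≤n
... | no ¬p0 with least {λ m → P (suc m)} (P? ∘ suc) pB
...   | k , pk , minimal = suc k , pk , λ { {zero} p0 → ⊥-elim (¬p0 p0) ; {suc m} pm → s≤s (minimal pm) }

module Walks {n : ℕ} (G : ColoredGraph n) where
  open ColoredGraph G

  Adj-sym : ∀ {u v} → Adj u v → Adj v u
  Adj-sym {u} {v} = subst T (adj-sym u v)

  Adj-irrefl : ∀ {u v} → Adj u v → u ≢ v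
  Adj-irrefl {u} u~u refl = subst T (adj-irr u) u~u

  Adj⁼ : Fin n → Fin n → Set
  Adj⁼ = ReflClosure Adj

  -- Walks may pause at a vertex; this lets maps that contract edges act on walks.
  infixr 5 _◅_ _◅◅_
  data Walk : Fin n → Fin n → Set where
    nil : ∀ u → Walk u u
    _◅_ : ∀ {u v w} → Adj⁼ u v → Walk v w → Walk u w

  len : ∀ {u v} → Walk u v → ℕ
  len (nil _) = 0
  len (_ ◅ W) = suc (len W)

  verts : ∀ {u v} → Walk u v → List (Fin n)
  verts (nil u)       = u ∷ []
  verts (_◅_ {u} _ W) = u ∷ verts W

  _◅◅_ : ∀ {u v w} → Walk u v → Walk v w → Walk u w
  nil _   ◅◅ W′ = W′
  (e ◅ W) ◅◅ W′ = e ◅ (W ◅◅ W′)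

  reverse : ∀ {u v} → Walk u v → Walk v u
  reverse (nil u)       = nil u
  reverse (_◅_ {u} e W) = reverse W ◅◅ (ReflClosureₚ.sym Adj-sym e ◅ nil u)

  head∈verts : ∀ {u v} (W : Walk u v) → u ∈ verts W
  head∈verts (nil _) = here refl
  head∈verts (_ ◅ _) = here refl

  ∈-◅◅⁻ : ∀ {u v w x} (W : Walk u v) (W′ : Walk v w) →
          x ∈ verts (W ◅◅ W′) → x ∈ verts W ⊎ x ∈ verts W′
  ∈-◅◅⁻ (nil _) W′ x∈       = inj₂ x∈
  ∈-◅◅⁻ (_ ◅ W) W′ (here eq)  = inj₁ (here eq)
  ∈-◅◅⁻ (_ ◅ W) W′ (there x∈) = Sum.map₁ there (∈-◅◅⁻ W W′ x∈)

  ∈-reverse⁻ : ∀ {u v x} (W : Walk u v) → x ∈ verts (reverse W) → x ∈ verts W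
  ∈-reverse⁻ (nil u) x∈ = x∈
  ∈-reverse⁻ (_◅_ {u} e W) x∈ with ∈-◅◅⁻ (reverse W) (ReflClosureₚ.sym Adj-sym e ◅ nil u) x∈
  ... | inj₁ x∈W                = there (∈-reverse⁻ W x∈W)
  ... | inj₂ (here refl)         = there (head∈verts W)
  ... | inj₂ (there (here refl)) = here refl

  prefix : ∀ {u v x} (W : Walk u v) → x ∈ verts W → Σ (Walk u x) λ W′ → verts W′ ⊆ verts W
  prefix (nil u) (here refl) = nil u , λ x∈ → x∈
  prefix (_ ◅ _) (here refl) = nil _ , λ { (here eq) → here eq ; (there ()) }
  prefix (e ◅ W) (there x∈) with prefix W x∈
  ... | W′ , W′⊆W = e ◅ W′ , λ { (here eq) → here eq ; (there y∈) → there (W′⊆W y∈) }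

  Within : Subset n → ∀ {u v} → Walk u v → Set
  Within S W = All (_∈ₛ S) (verts W)

  within-⊤ : ∀ {u v} (W : Walk u v) → Within ⊤ W
  within-⊤ W = All.tabulate (λ _ → ∈⊤)

  verts-subst₂ : ∀ {u v u′ v′} (u≡ : u ≡ u′) (v≡ : v ≡ v′) (W : Walk u v) →
                 verts (subst₂ Walk u≡ v≡ W) ≡ verts W
  verts-subst₂ refl refl _ = refl

  module _ (f : Fin n → Fin n) {S : Subset n}
           (f-step : ∀ {x y} → x ∈ₛ S → y ∈ₛ S → Adj⁼ x y → Adj⁼ (f x) (f y)) where

    mapWalk : ∀ {u v} (W : Walk u v) → Within S W → Walk (f u) (f v)
    mapWalk (nil u) _         = nil (f u)
    mapWalk (e ◅ W) (u∈ ∷ W⊆) = f-step u∈ (All.lookup W⊆ (head∈verts W)) e ◅ mapWalk W W⊆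

    verts-mapWalk : ∀ {u v} (W : Walk u v) (W⊆ : Within S W) → verts (mapWalk W W⊆) ≡ map f (verts W)
    verts-mapWalk (nil _) _        = refl
    verts-mapWalk (_ ◅ W) (_ ∷ W⊆) = cong (f _ ∷_) (verts-mapWalk W W⊆)

    len-mapWalk : ∀ {u v} (W : Walk u v) (W⊆ : Within S W) → len (mapWalk W W⊆) ≡ len W
    len-mapWalk (nil _) _        = refl
    len-mapWalk (_ ◅ W) (_ ∷ W⊆) = cong suc (len-mapWalk W W⊆)

  linkedWalk : ∀ {u v} xs → Linked Adj (u ∷ xs) → last (u ∷ xs) ≡ just v →
               Σ (Walk u v) λ W → len W ≡ length xs
  linkedWalk [] _ last≡ with just-injective last≡
  ... | refl = nil _ , refl
  linkedWalk (_ ∷ xs) (u~x ∷ linked) last≡ with linkedWalk xs linked last≡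
  ... | W , lenW = [ u~x ] ◅ W , cong suc lenW

  path⇒walk : ∀ {u v p} → IsPath G u v p → Walk u v
  path⇒walk {p = []}     (() , _)
  path⇒walk {p = _ ∷ xs} (refl , last≡ , linked , _) = proj₁ (linkedWalk xs linked last≡)

  open DecMembership (_≟ᶠ_ {n}) using () renaming (_∈?_ to _∈ˡ?_)

  walk⇒path : ∀ {u v} (W : Walk u v) →
              ∃ λ p → IsPath G u v p × p ⊆ verts W × length p ≤ suc (len W)
  walk⇒path (nil u) = u ∷ [] , (refl , refl , [-] , [] ∷ []) , (λ x∈ → x∈) , ≤-refl
  walk⇒path (_◅_ {u} _ W) with walk⇒path W
  ... | p , (_ , last≡ , linked , unique) , p⊆W , |p|≤ with u ∈ˡ? p
  ... | yes u∈p with ∈-∃++ u∈p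
  ...   | xs , ys , refl =
          u ∷ ys
        , (refl , trans (sym (last-++-∷ xs u ys)) last≡ , linked-++⁻ʳ xs linked , unique-++⁻ʳ xs unique)
        , there ∘ p⊆W ∘ ∈-++⁺ʳ xs
        , ≤-trans (length-++-≤ʳ (u ∷ ys) {xs}) (m≤n⇒m≤1+n |p|≤)
  walk⇒path (_ ◅ _) | [] , (() , _) , _ | no _
  walk⇒path (refl ◅ _) | _ ∷ _ , (refl , _) , _ | no u∉p = ⊥-elim (u∉p (here refl))
  walk⇒path (_◅_ {u} [ u~v ] _) | v ∷ p , (refl , last≡ , linked , unique) , p⊆W , |p|≤ | no u∉p =
      u ∷ v ∷ p
    , (refl , last≡ , u~v ∷ linked , ¬Any⇒All¬ _ u∉p ∷ unique)
    , (λ { (here eq) → here eq ; (there x∈) → there (p⊆W x∈) })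
    , s≤s |p|≤

module BlockGraphs {n : ℕ} (G : ColoredGraph n) where
  open ColoredGraph G
  open Walks G

  record InducedPath₃ (p q r : Fin n) : Set where
    field
      p~q : Adj p q
      q~r : Adj q r
      p≢r : p ≢ r
      p≁r : ¬ Adj p r
  open InducedPath₃

  MidpointsSeparate : Subset n → Set
  MidpointsSeparate X = ∀ {p q r} → p ∈ₛ X → q ∈ₛ X → r ∈ₛ X → InducedPath₃ p q r →
                        (W : Walk p r) → Within X W → q ∈ verts W

  Separates : Subset n → Fin n → Subset n → Subset n → Set
  Separates S c A B = ∀ {x y} → x ∈ₛ A → y ∈ₛ B → (W : Walk x y) → Within S W → c ∈ verts W

  separates-walks : ∀ {S c A B} → (∀ x y p → x ∈ₛ A → y ∈ₛ B → IsPathIn G S x y p → c ∈ p) →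
                    Separates S c A B
  separates-walks separates x∈A y∈B W W⊆S with walk⇒path W
  ... | p , path , p⊆W , _ = p⊆W (separates _ _ p x∈A y∈B (path , anti-mono p⊆W W⊆S))

  separates-sym : ∀ {S c A B} → Separates S c A B → Separates S c B A
  separates-sym separates y∈B x∈A W W⊆S =
    ∈-reverse⁻ W (separates x∈A y∈B (reverse W) (anti-mono (∈-reverse⁻ W) W⊆S))

  separated⇒¬Adj : ∀ {S c A B} → (∀ x → x ∈ₛ A → x ∈ₛ S) → (∀ x → x ∈ₛ B → x ∈ₛ S) →
                   c ∉ₛ A → c ∉ₛ B → Separates S c A B →
                   ∀ {x y} → x ∈ₛ A → y ∈ₛ B → ¬ Adj x y
  separated⇒¬Adj A⊆S B⊆S c∉A c∉B separates {x} {y} x∈A y∈B x~y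
    with separates x∈A y∈B ([ x~y ] ◅ nil y) (A⊆S x x∈A ∷ B⊆S y y∈B ∷ [])
  ... | here refl         = c∉A x∈A
  ... | there (here refl) = c∉B y∈B

  -- Contracting the side O onto the cut vertex c turns S-walks into walks inside Z ∪ {c}.
  module Retraction {S : Subset n} (c : Fin n) (Z O : Subset n)
    (cover : ∀ x → x ∈ₛ S → x ≡ c ⊎ x ∈ₛ Z ⊎ x ∈ₛ O)
    (c∉O : c ∉ₛ O) (Z∩O : ∀ {x} → x ∈ₛ Z → x ∉ₛ O)
    (Z≁O : ∀ {x y} → x ∈ₛ Z → y ∈ₛ O → ¬ Adj x y)
    (separates : Separates S c Z O) where

    X : Subset n
    X = Z ∪ ⁅ c ⁆

    c∈X : c ∈ₛ X
    c∈X = x∈p∪q⁺ (inj₂ (x∈⁅x⁆ c))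

    Z⊆X : ∀ {x} → x ∈ₛ Z → x ∈ₛ X
    Z⊆X x∈Z = x∈p∪q⁺ (inj₁ x∈Z)

    X∩O : ∀ {x} → x ∈ₛ X → x ∉ₛ O
    X∩O x∈X with x∈p∪q⁻ Z ⁅ c ⁆ x∈X
    ... | inj₁ x∈Z = Z∩O x∈Z
    ... | inj₂ x∈c rewrite x∈⁅y⁆⇒x≡y c x∈c = c∉O

    neighbour∈X : ∀ {x y} → x ∈ₛ Z → y ∈ₛ S → Adj x y → y ∈ₛ X
    neighbour∈X x∈Z y∈S x~y with cover _ y∈S
    ... | inj₁ refl         = c∈X
    ... | inj₂ (inj₁ y∈Z) = Z⊆X y∈Z
    ... | inj₂ (inj₂ y∈O) = ⊥-elim (Z≁O x∈Z y∈O x~y)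

    ρ : Fin n → Fin n
    ρ x with x ∈? O
    ... | yes _ = c
    ... | no _  = x

    ρ-fix : ∀ {x} → x ∉ₛ O → ρ x ≡ x
    ρ-fix {x} x∉O with x ∈? O
    ... | yes x∈O = ⊥-elim (x∉O x∈O)
    ... | no _    = refl

    ρ-into : ∀ {x} → x ∈ₛ S → ρ x ∈ₛ X
    ρ-into {x} x∈S with x ∈? O | cover x x∈S
    ... | yes _   | _                = c∈X
    ... | no _    | inj₁ refl        = c∈X
    ... | no _    | inj₂ (inj₁ x∈Z) = Z⊆X x∈Z
    ... | no x∉O | inj₂ (inj₂ x∈O) = ⊥-elim (x∉O x∈O)

    step-from-O : ∀ {x y} → x ∈ₛ O → y ∈ₛ S → y ∉ₛ O → Adj⁼ y x → y ≡ c
    step-from-O x∈O y∈S y∉O y~x with cover _ y∈S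
    ... | inj₁ y≡c         = y≡c
    ... | inj₂ (inj₂ y∈O) = ⊥-elim (y∉O y∈O)
    ... | inj₂ (inj₁ y∈Z) with y~x
    ...   | refl     = ⊥-elim (Z∩O y∈Z x∈O)
    ...   | [ y~x′ ] = ⊥-elim (Z≁O y∈Z x∈O y~x′)

    ρ-step : ∀ {x y} → x ∈ₛ S → y ∈ₛ S → Adj⁼ x y → Adj⁼ (ρ x) (ρ y)
    ρ-step {x} {y} x∈S y∈S x~y with x ∈? O | y ∈? O
    ... | yes _   | yes _   = refl
    ... | yes x∈O | no y∉O = ReflClosure.reflexive (sym (step-from-O x∈O y∈S y∉O (ReflClosureₚ.sym Adj-sym x~y)))
    ... | no x∉O | yes y∈O = ReflClosure.reflexive (step-from-O y∈O x∈S x∉O x~y)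
    ... | no _    | no _    = x~y

    retractWalk : ∀ {p r} → p ∈ₛ X → r ∈ₛ X → (W : Walk p r) → Within S W →
                  Σ (Walk p r) λ W′ → Within X W′ × verts W′ ≡ map ρ (verts W)
    retractWalk p∈X r∈X W W⊆S =
        subst₂ Walk (ρ-fix (X∩O p∈X)) (ρ-fix (X∩O r∈X)) ρW
      , subst (All (_∈ₛ X)) (sym verts≡) (map⁺ (All.map ρ-into W⊆S))
      , verts≡
      where
      ρW = mapWalk ρ ρ-step W W⊆S
      verts≡ = trans (verts-subst₂ _ _ ρW) (verts-mapWalk ρ ρ-step W W⊆S)

    ρ-vertex∈walk : ∀ {p r y} → p ∈ₛ X → (W : Walk p r) → Within S W → y ∈ verts W → ρ y ∈ verts W
    ρ-vertex∈walk {y = y} p∈X W W⊆S y∈W with y ∈? O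
    ... | no _     = y∈W
    ... | yes y∈O with x∈p∪q⁻ Z ⁅ c ⁆ p∈X
    ...   | inj₂ p∈c = subst (_∈ verts W) (x∈⁅y⁆⇒x≡y c p∈c) (head∈verts W)
    ...   | inj₁ p∈Z with prefix W y∈W
    ...     | W′ , W′⊆W = W′⊆W (separates p∈Z y∈O W′ (anti-mono W′⊆W W⊆S))

    retract : MidpointsSeparate X → ∀ {p q r} → p ∈ₛ X → q ∈ₛ X → r ∈ₛ X → InducedPath₃ p q r →
              (W : Walk p r) → Within S W → q ∈ verts W
    retract midpoints p∈X q∈X r∈X pqr W W⊆S with retractWalk p∈X r∈X W W⊆S
    ... | W′ , W′⊆X , verts≡ with ∈-map⁻ ρ (subst (_ ∈_) verts≡ (midpoints p∈X q∈X r∈X pqr W′ W′⊆X))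
    ...   | y , y∈W , refl = ρ-vertex∈walk p∈X W W⊆S y∈W

  module Split {S : Subset n} (c : Fin n) (A B : Subset n)
    (A⊆S : ∀ x → x ∈ₛ A → x ∈ₛ S) (B⊆S : ∀ x → x ∈ₛ B → x ∈ₛ S)
    (c∉A : c ∉ₛ A) (c∉B : c ∉ₛ B) (A∩B : ∀ x → x ∈ₛ A → x ∉ₛ B)
    (cover : ∀ x → x ∈ₛ S → x ≡ c ⊎ x ∈ₛ A ⊎ x ∈ₛ B)
    (separates : Separates S c A B) where

    A≁B : ∀ {x y} → x ∈ₛ A → y ∈ₛ B → ¬ Adj x y
    A≁B = separated⇒¬Adj A⊆S B⊆S c∉A c∉B separates

    module RA = Retraction c A B cover c∉B (A∩B _) A≁B separates
    module RB = Retraction c B A (λ x → Sum.map₂ Sum.swap ∘ cover x) c∉A (λ x∈B x∈A → A∩B _ x∈A x∈B)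
                  (λ x∈B y∈A → A≁B y∈A x∈B ∘ Adj-sym) (separates-sym separates)

    midpointsSeparate : MidpointsSeparate (A ∪ ⁅ c ⁆) → MidpointsSeparate (B ∪ ⁅ c ⁆) → MidpointsSeparate S
    midpointsSeparate midA midB p∈ q∈ r∈ pqr W W⊆S with cover _ q∈
    ... | inj₂ (inj₁ q∈A) = RA.retract midA (RA.neighbour∈X q∈A p∈ (Adj-sym (p~q pqr))) (RA.Z⊆X q∈A)
                              (RA.neighbour∈X q∈A r∈ (q~r pqr)) pqr W W⊆S
    ... | inj₂ (inj₂ q∈B) = RB.retract midB (RB.neighbour∈X q∈B p∈ (Adj-sym (p~q pqr))) (RB.Z⊆X q∈B)
                              (RB.neighbour∈X q∈B r∈ (q~r pqr)) pqr W W⊆S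
    ... | inj₁ refl with cover _ p∈ | cover _ r∈
    ...   | inj₁ refl         | _                 = ⊥-elim (Adj-irrefl (p~q pqr) refl)
    ...   | _                 | inj₁ refl         = ⊥-elim (Adj-irrefl (q~r pqr) refl)
    ...   | inj₂ (inj₁ p∈A) | inj₂ (inj₁ r∈A) = RA.retract midA (RA.Z⊆X p∈A) RA.c∈X (RA.Z⊆X r∈A) pqr W W⊆S
    ...   | inj₂ (inj₂ p∈B) | inj₂ (inj₂ r∈B) = RB.retract midB (RB.Z⊆X p∈B) RB.c∈X (RB.Z⊆X r∈B) pqr W W⊆S
    ...   | inj₂ (inj₁ p∈A) | inj₂ (inj₂ r∈B) = separates p∈A r∈B W W⊆S
    ...   | inj₂ (inj₂ p∈B) | inj₂ (inj₁ r∈A) = separates-sym separates p∈B r∈A W W⊆S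

  midpointsSeparate : ∀ {S} → BlockOrComplete G S → MidpointsSeparate S
  midpointsSeparate (complete clique) p∈ _ r∈ pqr _ _ = ⊥-elim (p≁r pqr (clique _ _ p∈ r∈ (p≢r pqr)))
  midpointsSeparate (split c A B _ A⊆S B⊆S c∉A c∉B A∩B cover separates blockA blockB) =
    Split.midpointsSeparate c A B A⊆S B⊆S c∉A c∉B A∩B cover (separates-walks separates)
      (midpointsSeparate blockA) (midpointsSeparate blockB)

  midpoint∈walk : IsBlockGraph G → ∀ {p q r} → InducedPath₃ p q r → (W : Walk p r) → q ∈ verts W
  midpoint∈walk blockGraph pqr W = midpointsSeparate blockGraph ∈⊤ ∈⊤ ∈⊤ pqr W (within-⊤ W)

module Distance {n : ℕ} (G : ColoredGraph n) (connected : Connected G) where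
  open ColoredGraph G
  open Walks G

  Reach : ℕ → Fin n → Fin n → Set
  Reach k u v = Σ (Walk u v) λ W → len W ≤ k

  Adj⁼? : ∀ u v → Dec (Adj⁼ u v)
  Adj⁼? = ReflClosureₚ.dec {_~_ = Adj} _≟ᶠ_ (λ u v → T? (adj u v))

  reach? : ∀ k u v → Dec (Reach k u v)
  reach? zero u v with u ≟ᶠ v
  ... | yes refl = yes (nil u , z≤n)
  ... | no u≢v  = no λ { (nil _ , _) → u≢v refl ; (_ ◅ _ , ()) }
  reach? (suc k) u v with any? (λ x → Adj⁼? u x ×-dec reach? k x v)
  ... | yes (_ , e , W , lenW) = yes (e ◅ W , s≤s lenW)
  ... | no ¬next = no λ { (nil _ , _)         → ¬next (u , refl , nil u , z≤n)
                        ; (e ◅ W , s≤s lenW) → ¬next (_ , e , W , lenW) }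

  private
    shortestReach : ∀ u v → ∃ λ k → Reach k u v × (∀ {m} → Reach m u v → k ≤ m)
    shortestReach u v = least (λ k → reach? k u v) (path⇒walk (proj₂ (connected u v)) , ≤-refl)

  -- Abstract, so that type checking never unfolds the search behind d.
  abstract
    d : Fin n → Fin n → ℕ
    d u v = proj₁ (shortestReach u v)

    d-minimal : ∀ {u v} (W : Walk u v) → d u v ≤ len W
    d-minimal W = proj₂ (proj₂ (shortestReach _ _)) (W , ≤-refl)

    shortestWalk : ∀ u v → Σ (Walk u v) λ W → len W ≡ d u v
    shortestWalk u v with proj₁ (proj₂ (shortestReach u v))
    ... | W , lenW≤d = W , ≤-antisym lenW≤d (d-minimal W)

  d-step : ∀ {u v} w → Adj⁼ u v → d u w ≤ suc (d v w)
  d-step w u~v with shortestWalk _ w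
  ... | W , lenW = ≤-trans (d-minimal (u~v ◅ W)) (s≤s (≤-reflexive lenW))

  d-linked : ∀ {u v} xs → Linked Adj (u ∷ xs) → last (u ∷ xs) ≡ just v → d u v ≤ length xs
  d-linked xs linked last≡ with linkedWalk xs linked last≡
  ... | W , lenW = ≤-trans (d-minimal W) (≤-reflexive lenW)

  d-from-vertex : ∀ {u v x} (W : Walk u v) → x ∈ verts W → x ≡ u ⊎ d x v < len W
  d-from-vertex (nil _) (here x≡u)  = inj₁ x≡u
  d-from-vertex (_ ◅ W) (here x≡u)  = inj₁ x≡u
  d-from-vertex (_ ◅ W) (there x∈) with d-from-vertex W x∈
  ... | inj₁ refl = inj₂ (s≤s (d-minimal W))
  ... | inj₂ d<   = inj₂ (m≤n⇒m≤1+n d<)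

  shortestWalk-closer : ∀ {u v x} (W : Walk u v) → len W ≡ d u v → x ∈ verts W → x ≢ u → d x v < d u v
  shortestWalk-closer W lenW x∈W x≢u with d-from-vertex W x∈W
  ... | inj₁ x≡u = ⊥-elim (x≢u x≡u)
  ... | inj₂ x<W = <-≤-trans x<W (≤-reflexive lenW)

  d-map-≤ : (f : Fin n → Fin n) → (∀ {x y} → Adj x y → Adj (f x) (f y)) → ∀ u v → d (f u) (f v) ≤ d u v
  d-map-≤ f f-adj u v with shortestWalk u v
  ... | W , lenW = begin
      d (f u) (f v)                         ≤⟨ d-minimal (mapWalk f f-step W (within-⊤ W)) ⟩
      len (mapWalk f f-step W (within-⊤ W)) ≡⟨ len-mapWalk f f-step W (within-⊤ W) ⟩
      len W                                 ≡⟨ lenW ⟩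
      d u v                                 ∎
    where
    open ≤-Reasoning
    f-step : ∀ {x y} → x ∈ₛ ⊤ → y ∈ₛ ⊤ → Adj⁼ x y → Adj⁼ (f x) (f y)
    f-step _ _ = ReflClosure.map f-adj

  d-preserved : ∀ {σ} → IsAut G σ → ∀ u v → d (σ ⟨$⟩ʳ u) (σ ⟨$⟩ʳ v) ≡ d u v
  d-preserved {σ} (σ-adj , _) u v = ≤-antisym (d-map-≤ (σ ⟨$⟩ʳ_) σ-Adj u v) (begin
      d u v                                     ≡⟨ cong₂ d (sym (inverseˡ σ)) (sym (inverseˡ σ)) ⟩
      d (σ ⟨$⟩ˡ (σ ⟨$⟩ʳ u)) (σ ⟨$⟩ˡ (σ ⟨$⟩ʳ v)) ≤⟨ d-map-≤ (σ ⟨$⟩ˡ_) σ⁻¹-Adj _ _ ⟩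
      d (σ ⟨$⟩ʳ u) (σ ⟨$⟩ʳ v)                   ∎)
    where
    open ≤-Reasoning
    σ-Adj : ∀ {x y} → Adj x y → Adj (σ ⟨$⟩ʳ x) (σ ⟨$⟩ʳ y)
    σ-Adj {x} {y} = subst T (sym (σ-adj x y))
    σ⁻¹-Adj : ∀ {x y} → Adj x y → Adj (σ ⟨$⟩ˡ x) (σ ⟨$⟩ˡ y)
    σ⁻¹-Adj {x} {y} = subst T (trans (sym (cong₂ adj (inverseʳ σ) (inverseʳ σ))) (σ-adj _ _))

  farthest : Fin n → Fin n
  farthest v = argmax (d v) v (allFin n)

  ecc : Fin n → ℕ
  ecc v = d v (farthest v)

  d≤ecc : ∀ v w → d v w ≤ ecc v
  d≤ecc v w = All.lookup (f[xs]≤f[argmax] v (allFin n)) (∈-allFin w)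

  ecc-preserved : ∀ {σ} → IsAut G σ → ∀ u → ecc (σ ⟨$⟩ʳ u) ≡ ecc u
  ecc-preserved {σ} aut u = ≤-antisym
    (begin
      ecc (σ ⟨$⟩ʳ u)                                      ≡⟨ cong (d _) (sym (inverseʳ σ)) ⟩
      d (σ ⟨$⟩ʳ u) (σ ⟨$⟩ʳ (σ ⟨$⟩ˡ farthest (σ ⟨$⟩ʳ u))) ≡⟨ d-preserved {σ} aut u _ ⟩
      d u (σ ⟨$⟩ˡ farthest (σ ⟨$⟩ʳ u))                    ≤⟨ d≤ecc u _ ⟩
      ecc u                                               ∎)
    (begin
      ecc u                            ≡⟨ sym (d-preserved {σ} aut u (farthest u)) ⟩
      d (σ ⟨$⟩ʳ u) (σ ⟨$⟩ʳ farthest u) ≤⟨ d≤ecc (σ ⟨$⟩ʳ u) _ ⟩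
      ecc (σ ⟨$⟩ʳ u)                   ∎)
    where open ≤-Reasoning

module Eccentricity {n : ℕ} (G : ColoredGraph n) (connected : Connected G) (blockGraph : IsBlockGraph G) where
  open ColoredGraph G
  open Walks G
  open BlockGraphs G
  open InducedPath₃
  open Distance G connected

  record Geodesic (u v : Fin n) (xs : List (Fin n)) : Set where
    constructor geodesic
    field
      linked   : Linked Adj (u ∷ xs)
      ends     : last (u ∷ xs) ≡ just v
      length≡d : length xs ≡ d u v

  shortest⇒geodesic : ∀ {u v p} → IsShortestPath G u v p → ∃ λ xs → p ≡ u ∷ xs × Geodesic u v xs
  shortest⇒geodesic {p = []} ((() , _) , _)
  shortest⇒geodesic {u} {v} {_ ∷ xs} ((refl , last≡ , linked , _) , minimal) =
    xs , refl , geodesic linked last≡ (≤-antisym |xs|≤d (d-linked xs linked last≡))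
    where
    |xs|≤d : length xs ≤ d u v
    |xs|≤d with shortestWalk u v
    ... | W , lenW with walk⇒path W
    ...   | q , q-path , _ , |q|≤ = ≤-pred (≤-trans (minimal q q-path) (≤-trans |q|≤ (s≤s (≤-reflexive lenW))))

  geodesic-tail : ∀ {u v x xs} → Geodesic u v (x ∷ xs) → Geodesic x v xs
  geodesic-tail {v = v} {xs = xs} (geodesic (u~x ∷ linked) last≡ len≡) =
    geodesic linked last≡ (≤-antisym (≤-pred (≤-trans (≤-reflexive len≡) (d-step v [ u~x ]))) (d-linked xs linked last≡))

  geodesic-reroute : ∀ {u v x xs ys} → Geodesic u v (x ∷ xs) → Geodesic x v ys → Geodesic u v (x ∷ ys)
  geodesic-reroute g@(geodesic (u~x ∷ _) _ len≡) (geodesic linked last≡ len≡′) =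
    geodesic (u~x ∷ linked) last≡ (trans (cong suc (trans len≡′ (sym (Geodesic.length≡d (geodesic-tail g))))) len≡)

  geodesic-induced : ∀ {u v x y xs} → Geodesic u v (x ∷ y ∷ xs) → InducedPath₃ u x y
  geodesic-induced {u} {y = y} {xs} (geodesic (u~x ∷ x~y ∷ linked) last≡ len≡) = record
    { p~q = u~x ; q~r = x~y ; p≢r = u≢y ; p≁r = u≁y }
    where
    u≢y : u ≢ y
    u≢y refl = 1+n≰n (≤-trans (n≤1+n _) (≤-trans (≤-reflexive len≡) (d-linked xs linked last≡)))
    u≁y : ¬ Adj u y
    u≁y u~y = 1+n≰n (≤-trans (≤-reflexive len≡) (d-linked (y ∷ xs) (u~y ∷ linked) last≡))

  ¬midpoint-farthest : ∀ {p q r} → InducedPath₃ p q r → ∀ w → d p w ≤ d q w → d r w ≤ d q w → ⊥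
  ¬midpoint-farthest {p} {r = r} pqr w p≤q r≤q with shortestWalk p w | shortestWalk r w
  ... | Wp , lenWp | Wr , lenWr with ∈-◅◅⁻ Wp (reverse Wr) (midpoint∈walk blockGraph pqr (Wp ◅◅ reverse Wr))
  ...   | inj₁ q∈Wp = <⇒≱ (shortestWalk-closer Wp lenWp q∈Wp (Adj-irrefl (p~q pqr) ∘ sym)) p≤q
  ...   | inj₂ q∈Wr = <⇒≱ (shortestWalk-closer Wr lenWr (∈-reverse⁻ Wr q∈Wr) (Adj-irrefl (q~r pqr))) r≤q

  ecc-strictly-increases : ∀ {p v q r xs} → Geodesic p v (q ∷ r ∷ xs) → ecc p ≤ ecc q → ecc q < ecc r
  ecc-strictly-increases {p} {q = q} {r} g p≤q = ≰⇒> λ r≤q →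
    ¬midpoint-farthest (geodesic-induced g) (farthest q) (≤-trans (d≤ecc p _) p≤q) (≤-trans (d≤ecc r _) r≤q)

  EdgeAbove : ℕ → Fin n × Fin n → Set
  EdgeAbove m (x , y) = Adj x y × m ≤ ecc x × m < ecc y

  edges-above : ∀ {p v q xs m} → Geodesic p v (q ∷ xs) → ecc p ≤ ecc q → m ≤ ecc q →
                All (EdgeAbove m) (pathEdges G (q ∷ xs))
  edges-above {xs = []}    _ _ _ = []
  edges-above {xs = _ ∷ _} g p≤q m≤q =
    (Linked.head (Linked.tail (Geodesic.linked g)) , m≤q , m<r) ∷ edges-above (geodesic-tail g) (<⇒≤ q<r) (<⇒≤ m<r)
    where
    q<r = ecc-strictly-increases g p≤q
    m<r = ≤-<-trans m≤q q<r

  closer-neighbour∈walk : ∀ {c a w} → Adj c a → d a w < d c w → (W : Walk c w) → a ∈ verts W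
  closer-neighbour∈walk {c} {a} {w} c~a a<c W with shortestWalk a w
  ... | nil _ , _ = ∈-reverse⁻ W (head∈verts (reverse W))
  ... | refl ◅ Wa , lenWa = ⊥-elim (1+n≰n (≤-trans (≤-reflexive lenWa) (d-minimal Wa)))
  ... | _◅_ {v = a₁} [ a~a₁ ] Wa , lenWa
        with ∈-◅◅⁻ W (reverse Wa) (midpoint∈walk blockGraph caa₁ (W ◅◅ reverse Wa))
    where
    a₁<c : 2 + d a₁ w ≤ d c w
    a₁<c = ≤-trans (s≤s (s≤s (d-minimal Wa))) (≤-trans (s≤s (≤-reflexive lenWa)) a<c)
    caa₁ : InducedPath₃ c a a₁
    caa₁ = record
      { p~q = c~a ; q~r = a~a₁
      ; p≢r = λ { refl → 1+n≰n (≤-trans a₁<c (n≤1+n _)) }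
      ; p≁r = λ c~a₁ → 1+n≰n (≤-trans a₁<c (d-step w [ c~a₁ ])) }
  ...   | inj₁ a∈W  = a∈W
  ...   | inj₂ a∈Wa with d-from-vertex Wa (∈-reverse⁻ Wa a∈Wa)
  ...     | inj₁ a≡a₁ = ⊥-elim (Adj-irrefl a~a₁ a≡a₁)
  ...     | inj₂ a<Wa = ⊥-elim (<⇒≱ a<Wa (≤-trans (n≤1+n _) (≤-reflexive lenWa)))

  closer-neighbour-unique : ∀ {c a b w} → Adj c a → Adj c b → d a w < d c w → d b w < d c w → a ≡ b
  closer-neighbour-unique {c} {w = w} c~a c~b a<c b<c with shortestWalk c w
  ... | nil _ , _ = ⊥-elim (n≮0 (<-≤-trans a<c (d-minimal (nil c))))
  ... | _◅_ {v = c₁} e W , lenW = trans (next c~a a<c) (sym (next c~b b<c))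
    where
    next : ∀ {x} → Adj c x → d x w < d c w → x ≡ c₁
    next c~x x<c with closer-neighbour∈walk c~x x<c (e ◅ W)
    ... | here x≡c = ⊥-elim (Adj-irrefl c~x (sym x≡c))
    ... | there x∈W with d-from-vertex W x∈W
    ...   | inj₁ x≡c₁ = x≡c₁
    ...   | inj₂ x<W  = ⊥-elim (<⇒≱ x<W (≤-pred (≤-trans (≤-reflexive lenW) (d-step w [ c~x ]))))

  module _ (rcop : IsRCOP G) where

    ecc-sum-invariant : ∀ {u v x y} → Adj u v → Adj x y → ecol x y ≡ ecol u v → ecc x + ecc y ≡ ecc u + ecc v
    ecc-sum-invariant {u} {v} u~v x~y same with proj₂ (proj₂ rcop) u v _ _ u~v x~y (sym same)
    ... | σ , aut , inj₁ (refl , refl) = cong₂ _+_ (ecc-preserved {σ} aut u) (ecc-preserved {σ} aut v)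
    ... | σ , aut , inj₂ (refl , refl) =
      trans (+-comm (ecc (σ ⟨$⟩ʳ v)) _) (cong₂ _+_ (ecc-preserved {σ} aut u) (ecc-preserved {σ} aut v))

    no-edge-of-colour : ∀ {u v m} → Adj u v → ecc u + ecc v ≤ m + m →
                        ∀ xs → All (EdgeAbove m) (pathEdges G xs) → NoEdgeOfColor G (ecol u v) xs
    no-edge-of-colour _ _ []       [] = []
    no-edge-of-colour _ _ (_ ∷ []) [] = []
    no-edge-of-colour {u} {v} u~v sum≤ (x ∷ y ∷ xs) ((x~y , m≤x , m<y) ∷ above) =
      different ∷ no-edge-of-colour u~v sum≤ (y ∷ xs) above
      where
      different : ecol x y ≢ ecol u v
      different same = <⇒≱ (+-mono-≤-< m≤x m<y) (≤-trans (≤-reflexive (ecc-sum-invariant u~v x~y same)) sum≤)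

    dominant-branch : ∀ {c a b v xs} → Adj c b → a ≢ b → Geodesic c v (a ∷ xs) → ecc b ≤ ecc a →
                      NoEdgeOfColor G (ecol c b) (a ∷ xs)
    dominant-branch {c} {a} {b} {xs = xs} c~b a≢b g b≤a =
      no-edge-of-colour c~b (+-mono-≤ c≤a b≤a) (a ∷ xs) (edges-above g c≤a ≤-refl)
      where
      c≤a : ecc c ≤ ecc a
      c≤a = ≮⇒≥ λ a<c → a≢b (closer-neighbour-unique (Linked.head (Geodesic.linked g)) c~b
              (≤-<-trans (d≤ecc a _) a<c) (≤-<-trans (d≤ecc b _) (≤-<-trans b≤a a<c)))

    one-branch-avoids : ∀ {c a b j l xs ys} → ecol c a ≢ ecol c b →
                        Geodesic c j (a ∷ xs) → Geodesic c l (b ∷ ys) →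
                        NoEdgeOfColor G (ecol c b) (a ∷ xs) ⊎ NoEdgeOfColor G (ecol c a) (b ∷ ys)
    one-branch-avoids {a = a} {b} colours≢ geoA geoB =
      Sum.map (dominant-branch (Linked.head (Geodesic.linked geoB)) a≢b geoA)
              (dominant-branch (Linked.head (Geodesic.linked geoA)) (a≢b ∘ sym) geoB)
              (≤-total (ecc b) (ecc a))
      where
      a≢b : a ≢ b
      a≢b refl = colours≢ refl

lemma4p7 : {n : ℕ} (G : ColoredGraph n) →
    Connected G → IsBlockGraph G → IsRCOP G →
    (c j l a b : Fin n) (P′ Q′ : List (Fin n)) →
    j ≢ c → l ≢ c →
    IsShortestPath G c j (c ∷ a ∷ P′) →
    IsShortestPath G c l (c ∷ b ∷ Q′) →
    (∀ x → x ∈ (c ∷ a ∷ P′) → x ∈ (c ∷ b ∷ Q′) → x ≡ c) →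
    ColoredGraph.ecol G c a ≢ ColoredGraph.ecol G c b →
    (R S : List (Fin n)) →
    IsShortestPath G a j R → IsShortestPath G b l S →
    NoEdgeOfColor G (ColoredGraph.ecol G c b) R
    ⊎ NoEdgeOfColor G (ColoredGraph.ecol G c a) S
-- Neither the disjointness of the two branches nor j, l ≢ c is needed.
lemma4p7 G connected blockGraph rcop c j l a b P′ Q′ _ _ shortestP shortestQ _ colours≢ R S shortestR shortestS
  with shortest⇒geodesic shortestP | shortest⇒geodesic shortestR
     | shortest⇒geodesic shortestQ | shortest⇒geodesic shortestS
  where open Eccentricity G connected blockGraph
... | _ , refl , geoP | _ , refl , geoR | _ , refl , geoQ | _ , refl , geoS =
  one-branch-avoids rcop colours≢ (geodesic-reroute geoP geoR) (geodesic-reroute geoQ geoS)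
  where open Eccentricity G connected blockGraph
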